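{- Let $V$ be a finite non-empty set and $T:\mathscr{P}(V)\to\mathscr{P}(V)$ a map. Suppose there exists a pair $(C,D)$ of equivalence relations on $V$ with $T(X)=\mathbf{u}_D(\mathbf{l}_C(X))$ for all $X\subseteq V$. Then there exists a pair $(E_1,E_2)$ of equivalence relations with $T(X)=\mathbf{u}_{E_2}(\mathbf{l}_{E_1}(X))$ for all $X$ satisfying: for all $E_2$-classes $[x]_{E_2}\neq[y]_{E_2}$, $\mathbf{u}_{E_1}([x]_{E_2})\neq\mathbf{u}_{E_1}([y]_{E_2})$. Furthermore, any such pair satisfies $E_1=S$ and $E_2=R$, with $R,S$ defined below.
   Context: For an equivalence relation $E$ on $V$: $\mathbf{l}_E(X)=\{x:[x]_E\subseteq X\}$, $\mathbf{u}_E(X)=\{x:[x]_E\cap X\neq\emptyset\}$. Let $J$ be the range of $T$; $a\sim_R b$ iff for every $X\in J$, $a\in X\Leftrightarrow b\in X$. Let $K$ be the set of all sets that are minimal with respect to $\subseteq$ among $\{X: T(X)=Y\}$ for some non-empty $Y\in J$; $a\sim_S b$ iff for every $X\in K$, $a\in X\Leftrightarrow b\in X$. -}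

module Defs where

open import Level using (0ℓ)
open import Data.Nat using (ℕ)
open import Data.Fin using (Fin)
open import Data.Fin.Subset using (Subset; _∈_; _⊆_; _∩_; Nonempty)
open import Data.Fin.Subset.Properties using (_⊆?_; nonempty?)
open import Data.Vec using (tabulate)
open import Data.Product using (∃; _×_)
open import Relation.Nullary using (does)
open import Relation.Binary using (Rel; IsDecEquivalence)
open import Relation.Binary.PropositionalEquality using (_≡_; _≢_)
open import Function.Bundles using (_⇔_)

record EqRel (n : ℕ) : Set₁ where
  field
    _≈_ : Rel (Fin n) 0ℓ
    isDecEquivalence : IsDecEquivalence _≈_
  open IsDecEquivalence isDecEquivalence public

open EqRel public using (_≈_)

module _ {n : ℕ} where

  class : EqRel n → Fin n → Subset n
  class E x = tabulate (λ y → does (EqRel._≟_ E x y))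

  lower : EqRel n → Subset n → Subset n
  lower E X = tabulate (λ x → does (class E x ⊆? X))

  upper : EqRel n → Subset n → Subset n
  upper E X = tabulate (λ x → does (nonempty? (class E x ∩ X)))

  InRange : (Subset n → Subset n) → Subset n → Set
  InRange T Y = ∃ λ Z → T Z ≡ Y

  R~ : (Subset n → Subset n) → Fin n → Fin n → Set
  R~ T a b = ∀ X → InRange T X → (a ∈ X ⇔ b ∈ X)

  InK : (Subset n → Subset n) → Subset n → Set
  InK T X = ∃ λ Y → InRange T Y × Nonempty Y × T X ≡ Y
                  × (∀ X' → T X' ≡ Y → X' ⊆ X → X' ≡ X)

  S~ : (Subset n → Subset n) → Fin n → Fin n → Set
  S~ T a b = ∀ X → InK T X → (a ∈ X ⇔ b ∈ X)

  SameRel : EqRel n → (Fin n → Fin n → Set) → Set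
  SameRel E P = ∀ a b → (_≈_ E a b ⇔ P a b)

  Represents : (Subset n → Subset n) → EqRel n → EqRel n → Set
  Represents T E₁ E₂ = ∀ X → T X ≡ upper E₂ (lower E₁ X)

  Separating : EqRel n → EqRel n → Set
  Separating E₁ E₂ = ∀ x y → class E₂ x ≢ class E₂ y
                   → upper E₁ (class E₂ x) ≢ upper E₁ (class E₂ y)

module Submission where

-- Everything reduces to one symmetry: x ∈ u_E([a]_F) and a ∈ u_F([x]_E) both say that
-- [x]_E and [a]_F meet. Since l_{E₁} fixes E₁-classes, T([x]_{E₁}) = u_{E₂}([x]_{E₁}), so
-- a ∈ T([x]_{E₁}) iff x ∈ u_{E₁}([a]_{E₂}); thus the sets of the range containing a
-- determine u_{E₁}([a]_{E₂}), and under separation that determines [a]_{E₂}, giving E₂ = R.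
-- Every minimal preimage of a non-empty set of the range is fixed by l_{E₁}, hence a union
-- of E₁-classes, and every E₁-class is such a minimal preimage, as no proper subset of it
-- has non-empty lower approximation; this gives E₁ = S. For existence keep C and coarsen D to the kernel
-- of x ↦ {z : x ∈ u_D([z]_C)}; by the same symmetry u_C of a class of this kernel is its
-- value under that map, so distinct classes are separated.

open import Defs
open import Data.Nat using (ℕ; suc)
open import Data.Fin using (Fin)
open import Data.Fin.Subset using (Subset; _∈_; _⊆_; _∩_; Nonempty)
open import Data.Fin.Subset.Properties
  using (_⊆?_; _∈?_; nonempty?; ⊆-antisym; x∈p∩q⁺; x∈p∩q⁻)
open import Data.Vec using (tabulate)
open import Data.Vec.Properties using (lookup∘tabulate; ≡-dec; []=⇒lookup; lookup⇒[]=)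
open import Data.Bool using (Bool; true)
import Data.Bool.Properties as Bool
import Relation.Binary.Construct.On as On
open import Data.Product using (∃; ∃₂; _×_; _,_)
open import Function using (_∘_; const)
open import Relation.Nullary using (Dec; yes; no; does; contradiction)
open import Relation.Binary.PropositionalEquality
  using (_≡_; refl; sym; trans; cong; subst)
open import Relation.Binary.PropositionalEquality.Properties using (isDecEquivalence)
open import Function.Bundles using (_⇔_; mk⇔; Equivalence)
import Function.Properties.Equivalence as ⇔

open Equivalence using (to; from)

module _ {n : ℕ} where

  ∈-tabulate : (f : Fin n → Bool) {x : Fin n} → x ∈ tabulate f ⇔ f x ≡ true
  ∈-tabulate f {x} = mk⇔
    (λ x∈ → trans (sym (lookup∘tabulate f x)) ([]=⇒lookup x∈))
    (λ fx → lookup⇒[]= x (tabulate f) (trans (lookup∘tabulate f x) fx))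

  does≡true⇔ : {P : Set} (P? : Dec P) → does P? ≡ true ⇔ P
  does≡true⇔ (yes p) = mk⇔ (const p) (const refl)
  does≡true⇔ (no ¬p) = mk⇔ (λ ()) (λ p → contradiction p ¬p)

  ∈-tabulate-does : {P : Fin n → Set} (P? : ∀ x → Dec (P x)) {x : Fin n} →
                    x ∈ tabulate (does ∘ P?) ⇔ P x
  ∈-tabulate-does P? {x} = ⇔.trans (∈-tabulate (does ∘ P?)) (does≡true⇔ (P? x))

  ∈-ext : {A B : Subset n} → (∀ x → x ∈ A ⇔ x ∈ B) → A ≡ B
  ∈-ext A⇔B = ⊆-antisym (λ {x} → to (A⇔B x)) (λ {x} → from (A⇔B x))

  module _ (E : EqRel n) where
    open EqRel E renaming (_≈_ to _∼_; refl to ∼-refl; sym to ∼-sym; trans to ∼-trans)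

    ∈-class : ∀ {x y} → y ∈ class E x ⇔ x ∼ y
    ∈-class {x} = ∈-tabulate-does (x ≟_)

    ∈-lower : ∀ {X x} → x ∈ lower E X ⇔ (∀ {y} → x ∼ y → y ∈ X)
    ∈-lower {X} {x} = ⇔.trans (∈-tabulate-does (λ x → class E x ⊆? X))
      (mk⇔ (λ [x]⊆X {y} x∼y → [x]⊆X (from ∈-class x∼y))
           (λ h {y} y∈[x] → h (to ∈-class y∈[x])))

    ∈-upper : ∀ {X x} → x ∈ upper E X ⇔ ∃ λ y → x ∼ y × y ∈ X
    ∈-upper {X} {x} = ⇔.trans (∈-tabulate-does (λ x → nonempty? (class E x ∩ X)))
      (mk⇔ (λ (y , y∈) → let (y∈[x] , y∈X) = x∈p∩q⁻ (class E x) X y∈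
                         in y , to ∈-class y∈[x] , y∈X)
           (λ (y , x∼y , y∈X) → y , x∈p∩q⁺ (from ∈-class x∼y , y∈X)))

    upper-closed : ∀ {X x y} → x ∼ y → x ∈ upper E X → y ∈ upper E X
    upper-closed x∼y x∈ =
      let (z , x∼z , z∈X) = to ∈-upper x∈ in from ∈-upper (z , ∼-trans (∼-sym x∼y) x∼z , z∈X)

    lower-closed : ∀ {X x y} → x ∼ y → x ∈ lower E X → y ∈ lower E X
    lower-closed x∼y x∈ = from ∈-lower (λ y∼z → to ∈-lower x∈ (∼-trans x∼y y∼z))

    lower-⊆ : ∀ {X} → lower E X ⊆ X
    lower-⊆ x∈ = to ∈-lower x∈ ∼-refl

    lower-idempotent : ∀ X → lower E (lower E X) ≡ lower E X
    lower-idempotent X = ⊆-antisym lower-⊆ (λ x∈ → from ∈-lower (λ x∼y → lower-closed x∼y x∈))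

    lower-class : ∀ x → lower E (class E x) ≡ class E x
    lower-class x = ⊆-antisym lower-⊆
      (λ y∈ → from ∈-lower (λ y∼z → from ∈-class (∼-trans (to ∈-class y∈) y∼z)))

    class-cong : ∀ {x y} → x ∼ y → class E x ≡ class E y
    class-cong x∼y = ⊆-antisym
      (λ z∈ → from ∈-class (∼-trans (∼-sym x∼y) (to ∈-class z∈)))
      (λ z∈ → from ∈-class (∼-trans x∼y (to ∈-class z∈)))

    class-injective : ∀ {x y} → class E x ≡ class E y → x ∼ y
    class-injective {x} {y} eq = to ∈-class (subst (y ∈_) (sym eq) (from ∈-class ∼-refl))

    ⊆-class-minimal : ∀ {X a} → X ⊆ class E a → Nonempty (lower E X) → X ≡ class E a
    ⊆-class-minimal X⊆[a] (y , y∈lX) = ⊆-antisym X⊆[a] (λ z∈[a] →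
      to ∈-lower y∈lX (∼-trans (∼-sym (to ∈-class (X⊆[a] (lower-⊆ y∈lX)))) (to ∈-class z∈[a])))

  ∈-upper-class-comm : (E F : EqRel n) {x a : Fin n} →
                       x ∈ upper E (class F a) ⇔ a ∈ upper F (class E x)
  ∈-upper-class-comm E F = mk⇔ (swap E F) (swap F E)
    where
    swap : (E F : EqRel n) {x a : Fin n} → x ∈ upper E (class F a) → a ∈ upper F (class E x)
    swap E F x∈ =
      let (y , x∼y , y∈[a]) = to (∈-upper E) x∈
      in from (∈-upper F) (y , to (∈-class F) y∈[a] , from (∈-class E) x∼y)

  module _ {T : Subset n → Subset n} {E₁ E₂ : EqRel n} (rep : Represents T E₁ E₂) where
    open EqRel E₁ using () renaming (_≈_ to _∼₁_; refl to ∼₁-refl; sym to ∼₁-sym)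
    open EqRel E₂ using () renaming (_≈_ to _∼₂_; refl to ∼₂-refl; sym to ∼₂-sym; _≟_ to _≟₂_)

    ∼₂⇒R~ : ∀ {a b} → a ∼₂ b → R~ T a b
    ∼₂⇒R~ a∼b X (Z , refl) rewrite rep Z =
      mk⇔ (upper-closed E₂ a∼b) (upper-closed E₂ (∼₂-sym a∼b))

    ∈-T-class : ∀ {a x} → a ∈ T (class E₁ x) ⇔ x ∈ upper E₁ (class E₂ a)
    ∈-T-class {a} {x} rewrite rep (class E₁ x) | lower-class E₁ x =
      ∈-upper-class-comm E₂ E₁

    R~⇒upper-class≡ : ∀ {a b} → R~ T a b → upper E₁ (class E₂ a) ≡ upper E₁ (class E₂ b)
    R~⇒upper-class≡ a~b = ∈-ext λ x →
      ⇔.trans (⇔.sym ∈-T-class) (⇔.trans (a~b (T (class E₁ x)) (_ , refl)) ∈-T-class)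

    R~⇒∼₂ : Separating E₁ E₂ → ∀ {a b} → R~ T a b → a ∼₂ b
    R~⇒∼₂ sep {a} {b} a~b with a ≟₂ b
    ... | yes a∼b = a∼b
    ... | no a≁b = contradiction (R~⇒upper-class≡ a~b) (sep a b (a≁b ∘ class-injective E₂))

    T∘lower : ∀ X → T (lower E₁ X) ≡ T X
    T∘lower X = trans (rep _) (trans (cong (upper E₂) (lower-idempotent E₁ X)) (sym (rep X)))

    InK⇒lower-fixed : ∀ {X} → InK T X → lower E₁ X ≡ X
    InK⇒lower-fixed {X} (_ , _ , _ , TX≡Y , minimal) =
      minimal (lower E₁ X) (trans (T∘lower X) TX≡Y) (lower-⊆ E₁)

    ∼₁⇒S~ : ∀ {a b} → a ∼₁ b → S~ T a b
    ∼₁⇒S~ a∼b X X∈K = mk⇔ (closed a∼b) (closed (∼₁-sym a∼b))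
      where
      closed : ∀ {u v} → u ∼₁ v → u ∈ X → v ∈ X
      closed {u} u∼v u∈X = to (∈-lower E₁) (subst (u ∈_) (sym (InK⇒lower-fixed X∈K)) u∈X) u∼v

    class-InK : ∀ a → InK T (class E₁ a)
    class-InK a = T [a] , ([a] , refl) , (a , a∈T[a]) , refl , minimal
      where
      [a] = class E₁ a
      a∈T[a] : a ∈ T [a]
      a∈T[a] = from ∈-T-class (from (∈-upper E₁) (a , ∼₁-refl , from (∈-class E₂) ∼₂-refl))
      minimal : ∀ X → T X ≡ T [a] → X ⊆ [a] → X ≡ [a]
      minimal X TX≡T[a] X⊆[a]
        with to (∈-upper E₂) (subst (a ∈_) (trans (sym TX≡T[a]) (rep X)) a∈T[a])
      ... | y , _ , y∈lX = ⊆-class-minimal E₁ X⊆[a] (y , y∈lX)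

    S~⇒∼₁ : ∀ {a b} → S~ T a b → a ∼₁ b
    S~⇒∼₁ {a} a~b = to (∈-class E₁) (to (a~b _ (class-InK a)) (from (∈-class E₁) ∼₁-refl))

    separating⇒SameRel : Separating E₁ E₂ → SameRel E₁ (S~ T) × SameRel E₂ (R~ T)
    separating⇒SameRel sep =
      (λ _ _ → mk⇔ ∼₁⇒S~ S~⇒∼₁) , (λ _ _ → mk⇔ ∼₂⇒R~ (R~⇒∼₂ sep))

  kernel : {m : ℕ} → (Fin n → Subset m) → EqRel n
  kernel f = record
    { _≈_ = λ x y → f x ≡ f y
    ; isDecEquivalence = On.isDecEquivalence f (isDecEquivalence (≡-dec Bool._≟_))
    }

  module _ (C D : EqRel n) where
    open EqRel D using () renaming (_≈_ to _∼D_; refl to ∼D-refl; sym to ∼D-sym)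

    profile : Fin n → Subset n
    profile x = tabulate (λ z → does (x ∈? upper D (class C z)))

    ∈-profile : ∀ {x z} → z ∈ profile x ⇔ x ∈ upper D (class C z)
    ∈-profile {x} = ∈-tabulate-does (λ z → x ∈? upper D (class C z))

    coarsening : EqRel n
    coarsening = kernel profile

    ∼D⇒same-profile : ∀ {x y} → x ∼D y → profile x ≡ profile y
    ∼D⇒same-profile x∼y = ∈-ext λ _ →
      ⇔.trans ∈-profile (⇔.trans (mk⇔ (upper-closed D x∼y) (upper-closed D (∼D-sym x∼y)))
                                  (⇔.sym ∈-profile))

    upper-lower-coarsening : ∀ X → upper D (lower C X) ≡ upper coarsening (lower C X)
    upper-lower-coarsening X = ⊆-antisym
      (λ x∈ → let (y , x∼y , y∈lX) = to (∈-upper D) x∈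
              in from (∈-upper coarsening) (y , ∼D⇒same-profile x∼y , y∈lX))
      -- x shares the profile of y ∈ u_D([y]_C), so x has a D-neighbour w ∈ [y]_C, and w ∈ l_C(X)
      (λ x∈ → let (y , px≡py , y∈lX) = to (∈-upper coarsening) x∈
                  y∈py = from ∈-profile (from (∈-upper D) (y , ∼D-refl , from (∈-class C) (EqRel.refl C)))
                  (w , x∼w , w∈[y]) = to (∈-upper D) (to ∈-profile (subst (y ∈_) (sym px≡py) y∈py))
              in from (∈-upper D) (w , x∼w , lower-closed C (to (∈-class C) w∈[y]) y∈lX))

    upper-class-coarsening : ∀ z → upper D (class C z) ≡ upper coarsening (class C z)
    upper-class-coarsening z = subst (λ A → upper D A ≡ upper coarsening A)
      (lower-class C z) (upper-lower-coarsening (class C z))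

    ∈-upper-class-coarsening : ∀ {x z} → x ∈ upper coarsening (class C z) ⇔ z ∈ profile x
    ∈-upper-class-coarsening {x} {z} = ⇔.trans
      (mk⇔ (subst (x ∈_) (sym (upper-class-coarsening z))) (subst (x ∈_) (upper-class-coarsening z)))
      (⇔.sym ∈-profile)

    upper-coarsening-class : ∀ x → upper C (class coarsening x) ≡ profile x
    upper-coarsening-class x = ∈-ext λ _ →
      ⇔.trans (∈-upper-class-comm C coarsening) (∈-upper-class-coarsening {x})

    coarsening-separating : Separating C coarsening
    coarsening-separating x y [x]≢[y] u[x]≡u[y] = [x]≢[y] (class-cong coarsening {x} {y}
      (trans (sym (upper-coarsening-class x)) (trans u[x]≡u[y] (upper-coarsening-class y))))

mainTheorem17 : (n : ℕ) (T : Subset (suc n) → Subset (suc n))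
    → (∃₂ λ (C D : EqRel (suc n)) → ∀ X → T X ≡ upper D (lower C X))
    → (∃₂ λ (E₁ E₂ : EqRel (suc n)) → Represents T E₁ E₂ × Separating E₁ E₂)
      × (∀ (E₁ E₂ : EqRel (suc n)) → Represents T E₁ E₂ → Separating E₁ E₂
           → SameRel E₁ (S~ T) × SameRel E₂ (R~ T))
mainTheorem17 n T (C , D , T≡uD∘lC) =
  ( C , coarsening C D
  , (λ X → trans (T≡uD∘lC X) (upper-lower-coarsening C D X))
  , coarsening-separating C D )
  , λ E₁ E₂ → separating⇒SameRel {T = T} {E₁} {E₂}
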